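{- Let $(\Psi;\mathcal{E},\cdot,1,0)$ be an information algebra over the join-semilattice $(D;\le)$ and let $\perp$ be a ternary relation $x\perp y\mid z$ on $D$ satisfying C1–C4 such that the combination property and the extraction property relative to $\perp$ hold. For $x\in D$ let $P_x$ be the partition of $\Psi\setminus\{0\}$ into classes of $\phi\equiv_x\psi\iff\epsilon_x(\phi)=\epsilon_x(\psi)$. Then for all $x,y,z\in D$, $x\perp y\mid z$ implies $P_x\perp P_y\mid P_z$.
   Context: An information algebra $(\Psi;\mathcal{E},\cdot,1,0)$ consists of a set $\Psi$ with an associative, commutative, idempotent binary operation $\cdot$ with unit $1$ and null element $0$ ($\psi\cdot1=\psi$, $\psi\cdot0=0$), a join-semilattice $(D;\le)$ and maps $\epsilon_x:\Psi\to\Psi$ ($x\in D$), $\mathcal{E}=\{\epsilon_x\}$, with for all $x,y,\phi,\psi$: (E1) $\epsilon_x(0)=0$; (E2) $\psi\cdot\epsilon_x(\psi)=\psi$; (E3) $\epsilon_x(\epsilon_x(\phi)\cdot\psi)=\epsilon_x(\phi)\cdot\epsilon_x(\psi)$; (E4) some $x$ has $\epsilon_x(\psi)=\psi$; (E5) $\epsilon_x(\psi)=\psi$ and $x\le y$ imply $\epsilon_y(\psi)=\psi$. Conditions on a ternary relation on $D$: (C1) $x\perp y\mid y$; (C2) $x\perp y\mid z\Rightarrow y\perp x\mid z$; (C3) $x\perp y\mid z$ and $w\le y$ $\Rightarrow x\perp w\mid z$; (C4) $x\perp y\mid z\Rightarrow x\perp y\vee z\mid z$. Combination property: whenever $x\perp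 y\mid z$, $\epsilon_x(\phi)=\phi$ and $\epsilon_y(\psi)=\psi$, then $\epsilon_z(\phi\cdot\psi)=\epsilon_z(\phi)\cdot\epsilon_z(\psi)$. Extraction property: whenever $x\perp y\mid z$ and $\epsilon_x(\phi)=\phi$, then $\epsilon_y(\phi)=\epsilon_y(\epsilon_z(\phi))$. For partitions $P_1,P_2,P$ of a set, $P_1\perp P_2\mid P$ means: for every block $B$ of $P$, block $B_1$ of $P_1$, block $B_2$ of $P_2$ with $B_1\cap B\ne\emptyset\ne B_2\cap B$, we have $B_1\cap B_2\cap B\ne\emptyset$. -}

module Defs where

open import Level using (Level; _⊔_; suc)
open import Data.Product using (Σ; ∃; _×_; _,_)
open import Relation.Nullary using (¬_)
open import Relation.Binary.PropositionalEquality using (_≡_; _≢_)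
open import Relation.Binary.Lattice.Bundles using (JoinSemilattice)

record InformationAlgebra {c ℓ₁ ℓ₂ : Level} (D : JoinSemilattice c ℓ₁ ℓ₂) (a : Level)
       : Set (c ⊔ ℓ₁ ⊔ ℓ₂ ⊔ suc a) where
  open JoinSemilattice D using (Carrier; _≤_)
  infixl 7 _·_
  field
    Ψ      : Set a
    _·_    : Ψ → Ψ → Ψ
    𝟙      : Ψ
    𝟘      : Ψ
    ·-assoc : ∀ φ ψ χ → (φ · ψ) · χ ≡ φ · (ψ · χ)
    ·-comm  : ∀ φ ψ → φ · ψ ≡ ψ · φ
    ·-idem  : ∀ φ → φ · φ ≡ φ
    ·-unit  : ∀ ψ → ψ · 𝟙 ≡ ψ
    ·-null  : ∀ ψ → ψ · 𝟘 ≡ 𝟘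
    ε      : Carrier → Ψ → Ψ
    E1     : ∀ x → ε x 𝟘 ≡ 𝟘
    E2     : ∀ x ψ → ψ · ε x ψ ≡ ψ
    E3     : ∀ x φ ψ → ε x (ε x φ · ψ) ≡ ε x φ · ε x ψ
    E4     : ∀ ψ → ∃ λ x → ε x ψ ≡ ψ
    E5     : ∀ x y ψ → ε x ψ ≡ ψ → x ≤ y → ε y ψ ≡ ψ

module _ {c ℓ₁ ℓ₂ r : Level} (D : JoinSemilattice c ℓ₁ ℓ₂)
         (_⊥_∣_ : JoinSemilattice.Carrier D → JoinSemilattice.Carrier D →
                  JoinSemilattice.Carrier D → Set r) where
  open JoinSemilattice D using (Carrier; _≤_; _∨_)

  record SatisfiesC1-C4 : Set (c ⊔ ℓ₂ ⊔ r) where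
    field
      C1 : ∀ x y → x ⊥ y ∣ y
      C2 : ∀ x y z → x ⊥ y ∣ z → y ⊥ x ∣ z
      C3 : ∀ x y z w → x ⊥ y ∣ z → w ≤ y → x ⊥ w ∣ z
      C4 : ∀ x y z → x ⊥ y ∣ z → x ⊥ (y ∨ z) ∣ z

  module _ {a : Level} (A : InformationAlgebra D a) where
    open InformationAlgebra A

    CombinationProperty : Set (c ⊔ r ⊔ a)
    CombinationProperty = ∀ x y z φ ψ → x ⊥ y ∣ z → ε x φ ≡ φ → ε y ψ ≡ ψ →
                          ε z (φ · ψ) ≡ ε z φ · ε z ψ

    ExtractionProperty : Set (c ⊔ r ⊔ a)
    ExtractionProperty = ∀ x y z φ → x ⊥ y ∣ z → ε x φ ≡ φ →
                         ε y φ ≡ ε y (ε z φ)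

record Partition {a : Level} (S : Set a) (i b : Level) : Set (a ⊔ suc i ⊔ suc b) where
  field
    Block : Set i
    _∈B_  : S → Block → Set b

open Partition public

PartIndep : ∀ {a i b} {S : Set a} → (P₁ P₂ P : Partition S i b) → Set (a ⊔ i ⊔ b)
PartIndep {S = S} P₁ P₂ P =
  ∀ (B : Block P) (B₁ : Block P₁) (B₂ : Block P₂) →
  (∃ λ (s : S) → _∈B_ P₁ s B₁ × _∈B_ P s B) →
  (∃ λ (s : S) → _∈B_ P₂ s B₂ × _∈B_ P s B) →
  (∃ λ (s : S) → _∈B_ P₁ s B₁ × _∈B_ P₂ s B₂ × _∈B_ P s B)

module _ {c ℓ₁ ℓ₂ a : Level} {D : JoinSemilattice c ℓ₁ ℓ₂} (A : InformationAlgebra D a) where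
  open InformationAlgebra A

  NonNull : Set a
  NonNull = Σ Ψ λ φ → φ ≢ 𝟘

  -- P_x : the partition of Ψ ∖ {0} into classes of φ ≡ₓ ψ ⇔ εₓ(φ) = εₓ(ψ).
  -- Blocks are indexed by a representative; block [ρ] = { φ | εₓ φ = εₓ ρ }.
  P : JoinSemilattice.Carrier D → Partition NonNull a a
  P x = record
    { Block = NonNull
    ; _∈B_  = λ φ ρ → ε x (Σ.proj₁ φ) ≡ ε x (Σ.proj₁ ρ)
    }

-- Given s₁ in the x-block and s₂ in the y-block, both in the same z-block,
-- glue φ = εₓ s₁ · ε_z s₁ (supported on x ∨ z) and ψ = ε_y s₂ · ε_z s₂
-- (supported on y ∨ z).  From x ⊥ y ∣ z, C2 and C4 give (x ∨ z) ⊥ (y ∨ z) ∣ z,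
-- so the combination property makes ε_z (φ · ψ) = ε_z s₁; the extraction
-- property lets εₓ see ψ only through ε_z ψ = ε_z s₁, whence εₓ (φ · ψ) = εₓ s₁,
-- and symmetrically for y.  Finally φ · ψ ≠ 0 because its z-marginal is that
-- of s₁ ≠ 0.
module Submission where

open import Defs
open import Level using (Level)
open import Relation.Binary.Lattice.Bundles using (JoinSemilattice)
open import Data.Product using (_,_)
open import Relation.Binary.PropositionalEquality
  using (_≡_; _≢_; sym; trans; cong; cong₂; module ≡-Reasoning)

module InformationAlgebraProperties
  {c ℓ₁ ℓ₂ a : Level} {D : JoinSemilattice c ℓ₁ ℓ₂} (A : InformationAlgebra D a) where

  open JoinSemilattice D using (Carrier; _∨_; x≤x∨y; y≤x∨y)
  open InformationAlgebra A
  open ≡-Reasoning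

  Supports : Carrier → Ψ → Set a
  Supports w ψ = ε w ψ ≡ ψ

  ε-·-self : ∀ w ψ → ε w ψ · ψ ≡ ψ
  ε-·-self w ψ = trans (·-comm (ε w ψ) ψ) (E2 w ψ)

  ε-supports : ∀ w ψ → Supports w (ε w ψ)
  ε-supports w ψ = begin
    ε w (ε w ψ)          ≡⟨ cong (ε w) (sym (·-idem (ε w ψ))) ⟩
    ε w (ε w ψ · ε w ψ)  ≡⟨ E3 w ψ (ε w ψ) ⟩
    ε w ψ · ε w (ε w ψ)  ≡⟨ E2 w (ε w ψ) ⟩
    ε w ψ                ∎

  Supports-· : ∀ w φ ψ → Supports w φ → Supports w ψ → Supports w (φ · ψ)
  Supports-· w φ ψ sφ sψ = begin
    ε w (φ · ψ)      ≡⟨ cong (λ t → ε w (t · ψ)) (sym sφ) ⟩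
    ε w (ε w φ · ψ)  ≡⟨ E3 w φ ψ ⟩
    ε w φ · ε w ψ    ≡⟨ cong₂ _·_ sφ sψ ⟩
    φ · ψ            ∎

  ε-monotone : ∀ w φ ψ → ψ · φ ≡ ψ → ε w ψ · ε w φ ≡ ε w ψ
  ε-monotone w φ ψ ψ·φ≡ψ = begin
    ε w ψ · ε w φ            ≡⟨ ·-comm (ε w ψ) (ε w φ) ⟩
    ε w φ · ε w ψ            ≡⟨ sym (E3 w φ ψ) ⟩
    ε w (ε w φ · ψ)          ≡⟨ cong (ε w) (·-comm (ε w φ) ψ) ⟩
    ε w (ψ · ε w φ)          ≡⟨ cong (λ t → ε w (t · ε w φ)) (sym ψ·φ≡ψ) ⟩
    ε w ((ψ · φ) · ε w φ)    ≡⟨ cong (ε w) (·-assoc ψ φ (ε w φ)) ⟩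
    ε w (ψ · (φ · ε w φ))    ≡⟨ cong (λ t → ε w (ψ · t)) (E2 w φ) ⟩
    ε w (ψ · φ)              ≡⟨ cong (ε w) ψ·φ≡ψ ⟩
    ε w ψ                    ∎

  ε-absorbs-ε-ε : ∀ w v ψ → ε w ψ · ε w (ε v ψ) ≡ ε w ψ
  ε-absorbs-ε-ε w v ψ = ε-monotone w (ε v ψ) ψ (E2 v ψ)

  ε≡𝟘⇒≡𝟘 : ∀ w ψ → ε w ψ ≡ 𝟘 → ψ ≡ 𝟘
  ε≡𝟘⇒≡𝟘 w ψ εψ≡𝟘 = begin
    ψ          ≡⟨ sym (E2 w ψ) ⟩
    ψ · ε w ψ  ≡⟨ cong (ψ ·_) εψ≡𝟘 ⟩
    ψ · 𝟘      ≡⟨ ·-null ψ ⟩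
    𝟘          ∎

  ε-pair : Carrier → Carrier → Ψ → Ψ
  ε-pair x z ψ = ε x ψ · ε z ψ

  ε-pair-supports : ∀ x z ψ → Supports (x ∨ z) (ε-pair x z ψ)
  ε-pair-supports x z ψ = Supports-· (x ∨ z) (ε x ψ) (ε z ψ)
    (E5 x (x ∨ z) (ε x ψ) (ε-supports x ψ) (x≤x∨y x z))
    (E5 z (x ∨ z) (ε z ψ) (ε-supports z ψ) (y≤x∨y x z))

  ε-ε-pair : ∀ x z ψ → ε z (ε-pair x z ψ) ≡ ε z ψ
  ε-ε-pair x z ψ = begin
    ε z (ε x ψ · ε z ψ)  ≡⟨ cong (ε z) (·-comm (ε x ψ) (ε z ψ)) ⟩
    ε z (ε z ψ · ε x ψ)  ≡⟨ E3 z ψ (ε x ψ) ⟩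
    ε z ψ · ε z (ε x ψ)  ≡⟨ ε-absorbs-ε-ε z x ψ ⟩
    ε z ψ                ∎

module IndependenceProperties
  {c ℓ₁ ℓ₂ r : Level} (D : JoinSemilattice c ℓ₁ ℓ₂)
  {_⊥_∣_ : JoinSemilattice.Carrier D → JoinSemilattice.Carrier D →
           JoinSemilattice.Carrier D → Set r}
  (C : SatisfiesC1-C4 D _⊥_∣_) where

  open JoinSemilattice D using (_∨_)
  open SatisfiesC1-C4 C

  ⊥-join-left : ∀ {x y z} → x ⊥ y ∣ z → (x ∨ z) ⊥ y ∣ z
  ⊥-join-left {x} {y} {z} x⊥y∣z = C2 y (x ∨ z) z (C4 y x z (C2 x y z x⊥y∣z))

  ⊥-join-both : ∀ {x y z} → x ⊥ y ∣ z → (x ∨ z) ⊥ (y ∨ z) ∣ z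
  ⊥-join-both {x} {y} {z} x⊥y∣z = C4 (x ∨ z) y z (⊥-join-left x⊥y∣z)

module Amalgamation
  {c ℓ₁ ℓ₂ r a : Level} (D : JoinSemilattice c ℓ₁ ℓ₂)
  (A : InformationAlgebra D a)
  (_⊥_∣_ : JoinSemilattice.Carrier D → JoinSemilattice.Carrier D →
           JoinSemilattice.Carrier D → Set r)
  (C : SatisfiesC1-C4 D _⊥_∣_)
  (combination : CombinationProperty D _⊥_∣_ A)
  (extraction : ExtractionProperty D _⊥_∣_ A) where

  open JoinSemilattice D using (Carrier; _∨_)
  open InformationAlgebra A
  open InformationAlgebraProperties A
  open IndependenceProperties D C
  open SatisfiesC1-C4 C using (C2)
  open ≡-Reasoning

  ε-glue : ∀ w x z s ψ → w ⊥ x ∣ z → Supports w ψ → ε z ψ ≡ ε z s →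
           ε x (ε-pair x z s · ψ) ≡ ε x s
  ε-glue w x z s ψ w⊥x∣z sψ εzψ≡εzs = begin
    ε x ((ε x s · ε z s) · ψ)  ≡⟨ cong (ε x) (·-assoc (ε x s) (ε z s) ψ) ⟩
    ε x (ε x s · (ε z s · ψ))  ≡⟨ cong (λ t → ε x (ε x s · (t · ψ))) (sym εzψ≡εzs) ⟩
    ε x (ε x s · (ε z ψ · ψ))  ≡⟨ cong (λ t → ε x (ε x s · t)) (ε-·-self z ψ) ⟩
    ε x (ε x s · ψ)            ≡⟨ E3 x s ψ ⟩
    ε x s · ε x ψ              ≡⟨ cong (ε x s ·_) (extraction w x z ψ w⊥x∣z sψ) ⟩
    ε x s · ε x (ε z ψ)        ≡⟨ cong (λ t → ε x s · ε x t) εzψ≡εzs ⟩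
    ε x s · ε x (ε z s)        ≡⟨ ε-absorbs-ε-ε x z s ⟩
    ε x s                      ∎

  amalgam : Carrier → Carrier → Carrier → Ψ → Ψ → Ψ
  amalgam x y z s₁ s₂ = ε-pair x z s₁ · ε-pair y z s₂

  module _ {x y z : Carrier} (x⊥y∣z : x ⊥ y ∣ z) {s₁ s₂ : Ψ} (εz≡ : ε z s₁ ≡ ε z s₂) where

    ε-amalgam-left : ε x (amalgam x y z s₁ s₂) ≡ ε x s₁
    ε-amalgam-left = ε-glue (y ∨ z) x z s₁ (ε-pair y z s₂)
      (⊥-join-left (C2 x y z x⊥y∣z)) (ε-pair-supports y z s₂)
      (trans (ε-ε-pair y z s₂) (sym εz≡))

    ε-amalgam-right : ε y (amalgam x y z s₁ s₂) ≡ ε y s₂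
    ε-amalgam-right = begin
      ε y (ε-pair x z s₁ · ε-pair y z s₂)  ≡⟨ cong (ε y) (·-comm (ε-pair x z s₁) (ε-pair y z s₂)) ⟩
      ε y (ε-pair y z s₂ · ε-pair x z s₁)  ≡⟨ ε-glue (x ∨ z) y z s₂ (ε-pair x z s₁)
                                                (⊥-join-left x⊥y∣z) (ε-pair-supports x z s₁)
                                                (trans (ε-ε-pair x z s₁) εz≡) ⟩
      ε y s₂                                ∎

    ε-amalgam-middle : ε z (amalgam x y z s₁ s₂) ≡ ε z s₁
    ε-amalgam-middle = begin
      ε z (ε-pair x z s₁ · ε-pair y z s₂)
        ≡⟨ combination (x ∨ z) (y ∨ z) z (ε-pair x z s₁) (ε-pair y z s₂)
             (⊥-join-both x⊥y∣z) (ε-pair-supports x z s₁) (ε-pair-supports y z s₂) ⟩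
      ε z (ε-pair x z s₁) · ε z (ε-pair y z s₂)  ≡⟨ cong₂ _·_ (ε-ε-pair x z s₁) (ε-ε-pair y z s₂) ⟩
      ε z s₁ · ε z s₂                            ≡⟨ cong (ε z s₁ ·_) (sym εz≡) ⟩
      ε z s₁ · ε z s₁                            ≡⟨ ·-idem (ε z s₁) ⟩
      ε z s₁                                     ∎

    amalgam-≢𝟘 : s₁ ≢ 𝟘 → amalgam x y z s₁ s₂ ≢ 𝟘
    amalgam-≢𝟘 s₁≢𝟘 s≡𝟘 = s₁≢𝟘 (ε≡𝟘⇒≡𝟘 z s₁ (begin
      ε z s₁                    ≡⟨ sym ε-amalgam-middle ⟩
      ε z (amalgam x y z s₁ s₂) ≡⟨ cong (ε z) s≡𝟘 ⟩
      ε z 𝟘                     ≡⟨ E1 z ⟩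
      𝟘                         ∎))

  partition-independence : ∀ x y z → x ⊥ y ∣ z → PartIndep (P A x) (P A y) (P A z)
  partition-independence x y z x⊥y∣z (ρ , _) (ρ₁ , _) (ρ₂ , _)
    ((s₁ , s₁≢𝟘) , εx≡₁ , εz≡₁) ((s₂ , _) , εy≡₂ , εz≡₂) =
    (amalgam x y z s₁ s₂ , amalgam-≢𝟘 x⊥y∣z εz≡ s₁≢𝟘)
    , trans (ε-amalgam-left x⊥y∣z εz≡) εx≡₁
    , trans (ε-amalgam-right x⊥y∣z εz≡) εy≡₂
    , trans (ε-amalgam-middle x⊥y∣z εz≡) εz≡₁
    where
    εz≡ : ε z s₁ ≡ ε z s₂
    εz≡ = trans εz≡₁ (sym εz≡₂)

mainTheorem4 : ∀ {c ℓ₁ ℓ₂ r a : Level} (D : JoinSemilattice c ℓ₁ ℓ₂)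
                 (A : InformationAlgebra D a)
                 (_⊥_∣_ : JoinSemilattice.Carrier D → JoinSemilattice.Carrier D →
                          JoinSemilattice.Carrier D → Set r) →
                 SatisfiesC1-C4 D _⊥_∣_ →
                 CombinationProperty D _⊥_∣_ A →
                 ExtractionProperty D _⊥_∣_ A →
                 ∀ x y z → x ⊥ y ∣ z → PartIndep (P A x) (P A y) (P A z)
mainTheorem4 D A _⊥_∣_ C combination extraction =
  Amalgamation.partition-independence D A _⊥_∣_ C combination extraction
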